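{- Let $H$ be a digraph (possibly with loops), $D$ an $H$-colored digraph and $\mathscr{F}$ an $H$-class partition of $A(D)$ such that for every $F\in\mathscr{F}$, $D\langle F\rangle$ is strongly connected. Then: (a) $\mathscr{F}$ is walk-preservative; (b) $C_{\mathscr{F}}(D)$ is a symmetric digraph; (c) if $\mathcal{S}\subseteq V(C_{\mathscr{F}}(D))$ is an independent set in $C_{\mathscr{F}}(D)$ and $F_1,F_2$ are two different elements of $\mathcal{S}$, then $V(D\langle F_1\rangle)\cap V(D\langle F_2\rangle)=\emptyset$.
   Context: An $H$-colored digraph is a finite digraph $D$ without loops with a coloring $\rho:A(D)\to V(H)$. For $F\subseteq A(D)$, $D\langle F\rangle$ is the digraph with arc set $F$ and vertex set the vertices incident with an arc of $F$. An $H$-class partition of $A(D)$ is a partition $\mathscr{F}$ of $A(D)$ such that for all arcs $(u,v),(v,w)$ of $D$, $(\rho(u,v),\rho(v,w))\in A(H)$ iff some $F\in\mathscr{F}$ contains both arcs. $C_{\mathscr{F}}(D)$ has vertex set $\mathscr{F}$, and $(F,G)$ (possibly a loop) is an arc iff there exist $(u,v)\in F$ and $(v,w)\in G$. $\mathscr{F}$ is walk-preservative if for every arc $(F,G)$ of $C_{\mathscr{F}}(D)$ and every $z\in V(D\langle F\rangle)$ there is a $zw$-path in $D\langle F\rangle$ for some $w\in V(D\langle G\rangle)$. A digraph is symmetric if $(a,b)$ is an arc whenever $(b,a)$ is. A set is independent if there is no arc between two different vertices of it. -}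

module Defs where

open import Data.Nat using (ℕ)
open import Data.Fin using (Fin)
open import Data.Bool using (Bool; T)
open import Data.Product using (Σ; ∃; ∃-syntax; _×_; _,_)
open import Data.Sum using (_⊎_)
open import Data.List using (List; []; _∷_)
open import Data.List.Relation.Unary.Unique.Propositional using (Unique)
open import Data.Fin.Subset using (Subset; _∈_)
open import Relation.Binary.PropositionalEquality using (_≡_; _≢_)
open import Relation.Nullary using (¬_)
open import Function.Bundles using (_⇔_)

record Digraph : Set where
  field
    nV  : ℕ
    adj : Fin nV → Fin nV → Bool

  Arc : Fin nV → Fin nV → Set
  Arc u v = T (adj u v)

record HColoredDigraph (H : Digraph) : Set where
  field
    dig    : Digraph
    noLoop : ∀ v → ¬ Digraph.Arc dig v v
  open Digraph dig public
  field
    ρ : ∀ {u v} → Arc u v → Fin (Digraph.nV H)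

record ArcPartition {H : Digraph} (D : HColoredDigraph H) : Set where
  open HColoredDigraph D
  field
    k        : ℕ
    cls      : ∀ {u v} → Arc u v → Fin k
    nonempty : ∀ (F : Fin k) → ∃[ u ] ∃[ v ] Σ (Arc u v) (λ a → cls a ≡ F)

module _ {H : Digraph} {D : HColoredDigraph H} (𝓕 : ArcPartition D) where
  open HColoredDigraph D
  open ArcPartition 𝓕

  IsHClassPartition : Set
  IsHClassPartition =
    ∀ {u v w} (a : Arc u v) (b : Arc v w) →
      Digraph.Arc H (ρ a) (ρ b) ⇔ (∃[ F ] (cls a ≡ F × cls b ≡ F))

  -- v ∈ V(D⟨F⟩): v is incident with an arc of F.
  InV : Fin k → Fin nV → Set
  InV F v = ∃[ w ] ((Σ (Arc v w) λ a → cls a ≡ F) ⊎ (Σ (Arc w v) λ a → cls a ≡ F))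

  data Walk (F : Fin k) : Fin nV → Fin nV → Set where
    nil  : ∀ {x} → Walk F x x
    cons : ∀ {x y z} (a : Arc x y) → cls a ≡ F → Walk F y z → Walk F x z

  walkVertices : ∀ {F x y} → Walk F x y → List (Fin nV)
  walkVertices {x = x} nil = x ∷ []
  walkVertices {x = x} (cons a _ p) = x ∷ walkVertices p

  Path : Fin k → Fin nV → Fin nV → Set
  Path F x y = Σ (Walk F x y) λ p → Unique (walkVertices p)

  StronglyConnected : Fin k → Set
  StronglyConnected F = ∀ x y → InV F x → InV F y → Path F x y

  -- arcs of C_𝓕(D) (loops allowed)
  CArc : Fin k → Fin k → Set
  CArc F G = ∃[ u ] ∃[ v ] ∃[ w ] Σ (Arc u v) λ a → Σ (Arc v w) λ b → cls a ≡ F × cls b ≡ G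

  WalkPreservative : Set
  WalkPreservative = ∀ F G → CArc F G → ∀ z → InV F z → ∃[ w ] (InV G w × Path F z w)

  CSymmetric : Set
  CSymmetric = ∀ F G → CArc F G → CArc G F

  Independent : Subset k → Set
  Independent S = ∀ F G → F ∈ S → G ∈ S → F ≢ G → ¬ CArc F G

{-# OPTIONS --safe #-}
module Submission where

-- Strong connectivity of D⟨F⟩ means every vertex of D⟨F⟩ has both an in-arc and an
-- out-arc in F (as D has no loops, the path closing up an arc of F at that vertex is
-- nonempty). Hence a vertex shared by D⟨F⟩ and D⟨G⟩ carries an arc of F followed by an
-- arc of G, i.e. an arc (F, G) of C_𝓕(D); this gives both symmetry and part (c).

open import Defs
open import Data.Fin using (Fin)
open import Data.Fin.Subset using (Subset; _∈_)
open import Data.Product using (_×_; _,_; ∃-syntax; Σ; proj₁)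
open import Data.Sum using (inj₁; inj₂)
open import Data.Empty using (⊥-elim)
open import Relation.Binary.PropositionalEquality using (_≡_; _≢_; refl; ≢-sym)
open import Relation.Nullary using (¬_)

module ClassGraph {H : Digraph} {D : HColoredDigraph H} (𝓕 : ArcPartition D) where
  open HColoredDigraph D
  open ArcPartition 𝓕

  InArc : Fin k → Fin nV → Set
  InArc F v = ∃[ u ] Σ (Arc u v) λ a → cls a ≡ F

  OutArc : Fin k → Fin nV → Set
  OutArc F v = ∃[ w ] Σ (Arc v w) λ a → cls a ≡ F

  InArc⇒InV : ∀ {F v} → InArc F v → InV 𝓕 F v
  InArc⇒InV (u , a , e) = u , inj₂ (a , e)

  OutArc⇒InV : ∀ {F v} → OutArc F v → InV 𝓕 F v
  OutArc⇒InV (w , a , e) = w , inj₁ (a , e)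

  Arc⇒≢ : ∀ {u v} → Arc u v → u ≢ v
  Arc⇒≢ a refl = noLoop _ a

  cons⇒InArc : ∀ {F x y z} (a : Arc x y) → cls a ≡ F → Walk 𝓕 F y z → InArc F z
  cons⇒InArc {x = x} a e nil          = x , a , e
  cons⇒InArc         _ _ (cons b e p) = cons⇒InArc b e p

  Walk⇒InArc : ∀ {F x y} → Walk 𝓕 F x y → x ≢ y → InArc F y
  Walk⇒InArc nil          x≢y = ⊥-elim (x≢y refl)
  Walk⇒InArc (cons a e p) _   = cons⇒InArc a e p

  Walk⇒OutArc : ∀ {F x y} → Walk 𝓕 F x y → x ≢ y → OutArc F x
  Walk⇒OutArc nil                  x≢y = ⊥-elim (x≢y refl)
  Walk⇒OutArc (cons {y = y} a e _) _   = y , a , e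

  module _ {F} (sc : StronglyConnected 𝓕 F) where

    InV⇒InArc : ∀ {v} → InV 𝓕 F v → InArc F v
    InV⇒InArc (w , inj₂ (a , e)) = w , a , e
    InV⇒InArc {v} (w , inj₁ out) =
      Walk⇒InArc (proj₁ (sc w v (v , inj₂ out) (w , inj₁ out))) (≢-sym (Arc⇒≢ (proj₁ out)))

    InV⇒OutArc : ∀ {v} → InV 𝓕 F v → OutArc F v
    InV⇒OutArc (w , inj₁ (a , e)) = w , a , e
    InV⇒OutArc {v} (w , inj₂ inn) =
      Walk⇒OutArc (proj₁ (sc v w (w , inj₂ inn) (v , inj₁ inn))) (≢-sym (Arc⇒≢ (proj₁ inn)))

  InArc×OutArc⇒CArc : ∀ {F G v} → InArc F v → OutArc G v → CArc 𝓕 F G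
  InArc×OutArc⇒CArc {v = v} (u , a , ea) (w , b , eb) = u , v , w , a , b , ea , eb

  shared-vertex⇒CArc : ∀ {F G v} → StronglyConnected 𝓕 F → StronglyConnected 𝓕 G →
                       InV 𝓕 F v → InV 𝓕 G v → CArc 𝓕 F G
  shared-vertex⇒CArc scF scG v∈F v∈G = InArc×OutArc⇒CArc (InV⇒InArc scF v∈F) (InV⇒OutArc scG v∈G)

  CArc-sym : ∀ {F G} → StronglyConnected 𝓕 F → StronglyConnected 𝓕 G → CArc 𝓕 F G → CArc 𝓕 G F
  CArc-sym scF scG (u , v , w , a , b , ea , eb) =
    shared-vertex⇒CArc scG scF (OutArc⇒InV (w , b , eb)) (InArc⇒InV (u , a , ea))

  walkPreservative : (∀ F → StronglyConnected 𝓕 F) → WalkPreservative 𝓕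
  walkPreservative sc F G (u , v , w , a , b , ea , eb) z z∈F =
    v , OutArc⇒InV (w , b , eb) , sc F z v z∈F (InArc⇒InV (u , a , ea))

  independent⇒disjoint : (∀ F → StronglyConnected 𝓕 F) → ∀ S → Independent 𝓕 S →
    ∀ F₁ F₂ → F₁ ∈ S → F₂ ∈ S → F₁ ≢ F₂ → ∀ v → ¬ (InV 𝓕 F₁ v × InV 𝓕 F₂ v)
  independent⇒disjoint sc S indep F₁ F₂ F₁∈S F₂∈S F₁≢F₂ v (v∈F₁ , v∈F₂) =
    indep F₁ F₂ F₁∈S F₂∈S F₁≢F₂ (shared-vertex⇒CArc (sc F₁) (sc F₂) v∈F₁ v∈F₂)

lemma9 : (H : Digraph) (D : HColoredDigraph H) (𝓕 : ArcPartition D) →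
    IsHClassPartition 𝓕 →
    (∀ F → StronglyConnected 𝓕 F) →
    WalkPreservative 𝓕
    × CSymmetric 𝓕
    × (∀ (S : Subset (ArcPartition.k 𝓕)) → Independent 𝓕 S →
         ∀ F₁ F₂ → F₁ ∈ S → F₂ ∈ S → F₁ ≢ F₂ →
         ∀ (v : Fin (HColoredDigraph.nV D)) → ¬ (InV 𝓕 F₁ v × InV 𝓕 F₂ v))
lemma9 H D 𝓕 _ sc =
    walkPreservative sc
  , (λ F G → CArc-sym (sc F) (sc G))
  , independent⇒disjoint sc
  where open ClassGraph 𝓕
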